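{- Let $F=Ax^2+Bx+C\in\mathbb{Q}[x]$ be nonzero and reducible over $\mathbb{Q}$. Then $V(F)^{\mathrm{con}}_{0,1}$ is non-empty if and only if the multiset of roots of $F$ is $\{\pm 1/p^{\alpha},\mp p^{\alpha}\}$ for some integer $\alpha>0$, and in that case $V(F)^{\mathrm{con}}_{0,1}=\{\pm(1-p^{2\alpha})/p^{\alpha}\}$.
   Context: Let $p$ be a fixed odd prime and $\mathcal{O}=\mathbb{Z}[1/p]$. For a sequence $c_1,c_2,\dots$ put $A_0=1$, $A_1=c_1$, $A_n=c_nA_{n-1}+A_{n-2}$, $B_0=0$, $B_1=1$, $B_n=c_nB_{n-1}+B_{n-2}$; the $n$-th convergent is $[A_n:B_n]\in\mathbb{P}^1(\mathbb{Q})$ and $[c_1,c_2,\dots]$ converges $p$-adically if the convergents converge in $\mathbb{P}^1(\mathbb{Q}_p)$. The purely periodic continued fraction $[\overline{a_1}]=[a_1,a_1,\dots]$ of type $(0,1)$ is identified with $a_1\in\mathbb{A}^1$; its matrix is $E=\begin{pmatrix}a_1&1\\1&0\end{pmatrix}$. For nonzero $F=Ax^2+Bx+C$, $V(F)_{0,1}\subseteq\mathbb{A}^1$ is defined by $A(E_{22}-E_{11})=BE_{21}$, $-AE_{12}=CE_{21}$, $-BE_{12}=C(E_{22}-E_{11})$, i.e. $x^2-a_1x-1$ is proportional to $F$; $V(F)_{0,1}(\mathcal{O})$ denotes its points in $\mathcal{O}$ and $V(F)^{\mathrm{con}}_{0,1}$ the subset of $a_1$ for which $[\overline{a_1}]$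 converges $p$-adically. Roots of $F$ are taken in $\mathbb{P}^1(\overline{\mathbb{Q}})$ with multiplicity. -}

module Defs where

open import Data.Nat as ℕ using (ℕ; zero; suc)
open import Data.Nat.Properties using (m^n≢0)
open import Data.Nat.Divisibility using (_∣_)
open import Data.Integer using (+_)
open import Data.Rational as ℚ using (ℚ; 0ℚ; 1ℚ; _+_; _*_; -_; _-_)
open import Data.Product using (Σ; ∃; _×_; _,_)
open import Data.Sum using (_⊎_)
open import Relation.Nullary using (¬_)
open import Relation.Binary.PropositionalEquality using (_≡_; _≢_)

pPow : ℕ → ℕ → ℚ
pPow p k = + (p ℕ.^ k) ℚ./ 1

-- 1 / p ^ k as a rational number (junk value 0 for p = 0; p is prime)
invPow : ℕ → ℕ → ℚ
invPow zero    k = 0ℚ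
invPow (suc q) k = ℚ._/_ (+ 1) (suc q ℕ.^ k) {{m^n≢0 (suc q) k}}

-- The ring O = ℤ[1/p] inside ℚ : denominators are powers of p

InO : ℕ → ℚ → Set
InO p q = Σ ℕ λ k → ℚ.denominatorℕ q ≡ p ℕ.^ k

InZp : ℕ → ℚ → Set
InZp p q = ¬ (p ∣ ℚ.denominatorℕ q)

AbsLe : ℕ → ℚ → ℚ → Set
AbsLe p x y = Σ ℚ λ z → InZp p z × x ≡ z * y

IsMaxAbs : ℕ → ℚ → ℚ → ℚ → Set
IsMaxAbs p a b m = (m ≡ a ⊎ m ≡ b) × AbsLe p a m × AbsLe p b m

-- chordal p-adic distance on ℙ¹:
--   d([a:b],[c:d]) = |ad - bc|_p / (max(|a|_p,|b|_p) · max(|c|_p,|d|_p))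
-- ChordalLe p k P Q  means  d(P , Q) ≤ p ^ (- k)
ChordalLe : ℕ → ℕ → ℚ × ℚ → ℚ × ℚ → Set
ChordalLe p k (a , b) (c , d) =
  Σ ℚ λ m₁ → Σ ℚ λ m₂ → IsMaxAbs p a b m₁ × IsMaxAbs p c d m₂ ×
    AbsLe p (a * d - b * c) (pPow p k * m₁ * m₂)

-- Continued fractions [c₁, c₂, …]  (c is indexed from 1; c 0 is unused)

contA : (ℕ → ℚ) → ℕ → ℚ
contA c zero = 1ℚ
contA c (suc zero) = c 1
contA c (suc (suc n)) = c (suc (suc n)) * contA c (suc n) + contA c n

contB : (ℕ → ℚ) → ℕ → ℚ
contB c zero = 0ℚ
contB c (suc zero) = 1ℚ
contB c (suc (suc n)) = c (suc (suc n)) * contB c (suc n) + contB c n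

convergent : (ℕ → ℚ) → ℕ → ℚ × ℚ
convergent c n = contA c n , contB c n

-- Since ℚ_p is not
-- available, this is stated as the Cauchy property for the chordal metric
-- (ℙ¹(ℚ_p) is the compact, hence complete, metric space containing ℙ¹(ℚ)).
PAdicConverges : ℕ → (ℕ → ℚ) → Set
PAdicConverges p c =
  ∀ (k : ℕ) → ∃ λ N → ∀ m n → N ℕ.≤ m → N ℕ.≤ n →
    ChordalLe p k (convergent c m) (convergent c n)

-- Purely periodic continued fractions of type (0,1): [ā₁] ↔ a₁ ∈ 𝔸¹

E₁₁ E₁₂ E₂₁ E₂₂ : ℚ → ℚ
E₁₁ a₁ = a₁
E₁₂ a₁ = 1ℚ
E₂₁ a₁ = 1ℚ
E₂₂ a₁ = 0ℚ

InV : ℚ → ℚ → ℚ → ℚ → Set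
InV A B C a₁ =
  (A * (E₂₂ a₁ - E₁₁ a₁) ≡ B * E₂₁ a₁) ×
  (- (A * E₁₂ a₁) ≡ C * E₂₁ a₁) ×
  (- (B * E₁₂ a₁) ≡ C * (E₂₂ a₁ - E₁₁ a₁))

InVcon : ℕ → ℚ → ℚ → ℚ → ℚ → Set
InVcon p A B C a₁ = InO p a₁ × InV A B C a₁ × PAdicConverges p (λ _ → a₁)

NonzeroPoly : ℚ → ℚ → ℚ → Set
NonzeroPoly A B C = ¬ (A ≡ 0ℚ × B ≡ 0ℚ × C ≡ 0ℚ)

Reducible : ℚ → ℚ → ℚ → Set
Reducible A B C = Σ ℚ λ r → Σ ℚ λ s → Σ ℚ λ t → Σ ℚ λ u →
  (A ≡ r * t) × (B ≡ r * u + s * t) × (C ≡ s * u)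

-- the multiset of roots of F in ℙ¹ (with multiplicity) is {x₁, x₂} ⊆ ℚ,
-- i.e. F = A (x - x₁)(x - x₂) with A ≠ 0
RootsAre : ℚ → ℚ → ℚ → ℚ → ℚ → Set
RootsAre A B C x₁ x₂ = (A ≢ 0ℚ) × (B ≡ - (A * (x₁ + x₂))) × (C ≡ A * (x₁ * x₂))

IsSign : ℚ → Set
IsSign ε = ε ≡ 1ℚ ⊎ ε ≡ - 1ℚ

{-# OPTIONS --safe #-}
-- A point a₁ of V(F)_{0,1} makes F proportional to x² - a₁ x - 1, so reducibility of F gives a
-- rational x with x² = a₁ x + 1. When a₁ ∈ ℤ[1/p], clearing denominators shows that the coprime
-- numerator and denominator of x both divide a power of p, so x = ± p ^ j or ± p ^ (- i), and
-- a₁ = x - 1 / x = ε (1 - p ^ 2α) / p ^ α. For α = 0 this is a₁ = 0, whose convergents alternate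
-- between ∞ and 0. For α > 0 put q = p ^ α and c = ε (1 - q²), so a₁ = c / q with p ∤ c: the
-- scaled convergents q ^ n A n and q ^ n B n are integers with q ^ n A n ≡ c ^ n (mod p), and
-- q ^ (m + n) (A m B n - B m A n) is divisible by q ^ min m n, so the chordal distance between
-- the m-th and the n-th convergent is at most p ^ (- min m n).
module Submission where

open import Defs

-- A separate module, so that ℚ's _*_ used here does not clash with ℕ's _*_ in the statement.
module Lemmas where

  open import Data.Nat as ℕ using (ℕ; zero; suc)
  import Data.Nat.Properties as ℕP
  open import Data.Nat.Divisibility as ℕD using (divides)
  open import Data.Nat.Primality using (Prime; euclidsLemma; prime⇒nonZero; prime⇒irreducible; ¬prime[1])
  import Data.Nat.Coprimality as Coprime
  open import Data.Integer as ℤ using (ℤ; +_; -[1+_])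
  import Data.Integer.Properties as ℤP
  import Data.Integer.Divisibility.Signed as ℤD
  open import Data.Integer.Tactic.RingSolver as ℤ-Solver using ()
  open import Data.Rational as ℚ using (ℚ; 0ℚ; 1ℚ; _+_; _*_; -_; _-_; toℚᵘ; mkℚ)
  import Data.Rational.Properties as ℚP
  open import Data.Rational.Unnormalised as ℚᵘ using (mkℚᵘ; _≃_; *≡*)
  import Data.Rational.Unnormalised.Properties as ℚᵘP
  open import Algebra.Properties.Group ℚP.+-0-group using () renaming (∙-cancelʳ to +-cancelʳ)
  open import Level using (0ℓ)
  open import Tactic.RingSolver using (solve-∀)
  open import Tactic.RingSolver.Core.AlmostCommutativeRing using (AlmostCommutativeRing; fromCommutativeRing)
  open import Data.Product using (∃; _×_; _,_; proj₁; proj₂; map; map₂)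
  open import Data.Sum using (_⊎_; inj₁; inj₂)
  open import Data.Empty using (⊥-elim)
  open import Function using (_∘_)
  open import Function.Bundles using (_⇔_; mk⇔)
  open import Relation.Nullary using (¬_; yes; no; dec⇒maybe)
  open import Relation.Binary.PropositionalEquality

  -- The zero test lets the ring solver discard 0ℚ coefficients.
  ℚ-ring : AlmostCommutativeRing 0ℓ 0ℓ
  ℚ-ring = fromCommutativeRing ℚP.+-*-commutativeRing (λ x → dec⇒maybe (0ℚ ℚP.≟ x))

  toℚ : ℤ → ℚ
  toℚ z = z ℚ./ 1

  toℚᵘ-toℚ : ∀ z → toℚᵘ (toℚ z) ≃ mkℚᵘ z 0
  toℚᵘ-toℚ z = ℚP.toℚᵘ-fromℚᵘ (mkℚᵘ z 0)

  toℚ-+ : ∀ x y → toℚ (x ℤ.+ y) ≡ toℚ x + toℚ y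
  toℚ-+ x y = ℚP.toℚᵘ-injective (begin-equality
    toℚᵘ (toℚ (x ℤ.+ y))               ≃⟨ toℚᵘ-toℚ (x ℤ.+ y) ⟩
    mkℚᵘ (x ℤ.+ y) 0                   ≃⟨ *≡* (cong (ℤ._* + 1) (cong₂ ℤ._+_ (ℤP.*-identityʳ x) (ℤP.*-identityʳ y))) ⟨
    mkℚᵘ x 0 ℚᵘ.+ mkℚᵘ y 0              ≃⟨ ℚᵘP.+-cong (toℚᵘ-toℚ x) (toℚᵘ-toℚ y) ⟨
    toℚᵘ (toℚ x) ℚᵘ.+ toℚᵘ (toℚ y)     ≃⟨ ℚP.toℚᵘ-homo-+ (toℚ x) (toℚ y) ⟨
    toℚᵘ (toℚ x + toℚ y)               ∎)
    where open ℚᵘP.≤-Reasoning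

  toℚ-neg : ∀ x → toℚ (ℤ.- x) ≡ - toℚ x
  toℚ-neg x = ℚP.toℚᵘ-injective (begin-equality
    toℚᵘ (toℚ (ℤ.- x))     ≃⟨ toℚᵘ-toℚ (ℤ.- x) ⟩
    ℚᵘ.- mkℚᵘ x 0          ≃⟨ ℚᵘP.-‿cong (toℚᵘ-toℚ x) ⟨
    ℚᵘ.- toℚᵘ (toℚ x)      ≃⟨ ℚP.toℚᵘ-homo‿- (toℚ x) ⟨
    toℚᵘ (- toℚ x)         ∎)
    where open ℚᵘP.≤-Reasoning

  toℚ-- : ∀ x y → toℚ (x ℤ.- y) ≡ toℚ x - toℚ y
  toℚ-- x y = trans (toℚ-+ x (ℤ.- y)) (cong (λ t → toℚ x + t) (toℚ-neg y))

  toℚ-* : ∀ x y → toℚ (x ℤ.* y) ≡ toℚ x * toℚ y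
  toℚ-* x y = ℚP.toℚᵘ-injective (begin-equality
    toℚᵘ (toℚ (x ℤ.* y))               ≃⟨ toℚᵘ-toℚ (x ℤ.* y) ⟩
    mkℚᵘ x 0 ℚᵘ.* mkℚᵘ y 0              ≃⟨ ℚᵘP.*-cong (toℚᵘ-toℚ x) (toℚᵘ-toℚ y) ⟨
    toℚᵘ (toℚ x) ℚᵘ.* toℚᵘ (toℚ y)     ≃⟨ ℚP.toℚᵘ-homo-* (toℚ x) (toℚ y) ⟨
    toℚᵘ (toℚ x * toℚ y)               ∎)
    where open ℚᵘP.≤-Reasoning

  toℚ-pos-* : ∀ m n → toℚ (+ (m ℕ.* n)) ≡ toℚ (+ m) * toℚ (+ n)
  toℚ-pos-* m n = trans (cong toℚ (ℤP.pos-* m n)) (toℚ-* (+ m) (+ n))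

  toℚ-injective : ∀ {x y} → toℚ x ≡ toℚ y → x ≡ y
  toℚ-injective {x} {y} eq
    with ℚᵘP.≃-trans (ℚᵘP.≃-sym (toℚᵘ-toℚ x)) (ℚᵘP.≃-trans (ℚP.toℚᵘ-cong eq) (toℚᵘ-toℚ y))
  ... | *≡* x*1≡y*1 = trans (sym (ℤP.*-identityʳ x)) (trans x*1≡y*1 (ℤP.*-identityʳ y))

  *-toℚ-↧≡toℚ-↥ : ∀ r → r * toℚ (ℚ.↧ r) ≡ toℚ (ℚ.↥ r)
  *-toℚ-↧≡toℚ-↥ r@(mkℚ n d _) = ℚP.toℚᵘ-injective (begin-equality
    toℚᵘ (r * toℚ (+ suc d))               ≃⟨ ℚP.toℚᵘ-homo-* r (toℚ (+ suc d)) ⟩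
    toℚᵘ r ℚᵘ.* toℚᵘ (toℚ (+ suc d))       ≃⟨ ℚᵘP.*-congˡ {toℚᵘ r} (toℚᵘ-toℚ (+ suc d)) ⟩
    mkℚᵘ n d ℚᵘ.* mkℚᵘ (+ suc d) 0          ≃⟨ *≡* (trans (ℤP.*-identityʳ _) (cong (λ m → n ℤ.* + m) d≡d*1)) ⟩
    mkℚᵘ n 0                               ≃⟨ toℚᵘ-toℚ n ⟨
    toℚᵘ (toℚ n)                           ∎)
    where
    open ℚᵘP.≤-Reasoning
    d≡d*1 = sym (ℕP.*-identityʳ (suc d))

  *-cancelʳ-≢0 : ∀ {x y w} → w ≢ 0ℚ → x * w ≡ y * w → x ≡ y
  *-cancelʳ-≢0 {x} {y} {w} w≢0 eq = begin
    x                 ≡⟨ identity x ⟩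
    x * w * ℚ.1/ w    ≡⟨ cong (_* ℚ.1/ w) eq ⟩
    y * w * ℚ.1/ w    ≡⟨ identity y ⟨
    y                 ∎
    where
    open ≡-Reasoning
    instance _ = ℚ.≢-nonZero w≢0
    identity : ∀ z → z ≡ z * w * ℚ.1/ w
    identity z = begin
      z                 ≡⟨ ℚP.*-identityʳ z ⟨
      z * 1ℚ            ≡⟨ cong (z *_) (ℚP.*-inverseʳ w) ⟨
      z * (w * ℚ.1/ w)  ≡⟨ ℚP.*-assoc z w _ ⟨
      z * w * ℚ.1/ w    ∎

  *-cancelˡ-≢0 : ∀ {x y w} → w ≢ 0ℚ → w * x ≡ w * y → x ≡ y
  *-cancelˡ-≢0 {x} {y} {w} w≢0 eq =
    *-cancelʳ-≢0 w≢0 (trans (ℚP.*-comm x w) (trans eq (ℚP.*-comm w y)))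

  prime∤1 : ∀ {p} → Prime p → ¬ (p ℕD.∣ 1)
  prime∤1 p-prime p∣1 = ¬prime[1] (subst Prime (ℕD.∣1⇒≡1 p∣1) p-prime)

  prime∤* : ∀ {p m n} → Prime p → ¬ (p ℕD.∣ m) → ¬ (p ℕD.∣ n) → ¬ (p ℕD.∣ m ℕ.* n)
  prime∤* {m = m} {n} p-prime p∤m p∤n p∣mn with euclidsLemma m n p-prime p∣mn
  ... | inj₁ p∣m = p∤m p∣m
  ... | inj₂ p∣n = p∤n p∣n

  ^-monoʳ-∣ : ∀ m {k n} → k ℕ.≤ n → m ℕ.^ k ℕD.∣ m ℕ.^ n
  ^-monoʳ-∣ m {n = n} ℕ.z≤n   = ℕD.1∣ (m ℕ.^ n)
  ^-monoʳ-∣ m (ℕ.s≤s k≤n) = ℕD.*-monoʳ-∣ m (^-monoʳ-∣ m k≤n)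

  ^-monoˡ-∣ : ∀ {m q} n → m ℕD.∣ q → m ℕ.^ n ℕD.∣ q ℕ.^ n
  ^-monoˡ-∣ zero    m∣q = ℕD.∣-refl
  ^-monoˡ-∣ (suc n) m∣q = ℕD.*-pres-∣ m∣q (^-monoˡ-∣ n m∣q)

  ∣prime^⇒≡prime^ : ∀ {p} → Prime p → ∀ k {d} → d ℕD.∣ p ℕ.^ k → ∃ λ i → d ≡ p ℕ.^ i
  ∣prime^⇒≡prime^ p-prime zero d∣1 = 0 , ℕD.∣1⇒≡1 d∣1
  ∣prime^⇒≡prime^ {p} p-prime (suc k) {d} d∣p^k+1 with p ℕD.∣? d
  ... | yes (divides e refl) =
    map suc (λ e≡p^i → trans (cong (ℕ._* p) e≡p^i) (ℕP.*-comm _ p)) (∣prime^⇒≡prime^ p-prime k e∣p^k)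
    where
    e∣p^k : e ℕD.∣ p ℕ.^ k
    e∣p^k = ℕD.*-cancelˡ-∣ p {{prime⇒nonZero p-prime}} (subst (ℕD._∣ p ℕ.* p ℕ.^ k) (ℕP.*-comm e p) d∣p^k+1)
  ... | no p∤d = ∣prime^⇒≡prime^ p-prime k (Coprime.coprime-divisor d⊥p d∣p^k+1)
    where
    d⊥p : Coprime.Coprime d p
    d⊥p (x∣d , x∣p) with prime⇒irreducible p-prime x∣p
    ... | inj₁ x≡1 = x≡1
    ... | inj₂ refl = ⊥-elim (p∤d x∣d)

  v*r≡u⇒↧ₙr∣∣v∣ : ∀ (u v : ℤ) r → toℚ v * r ≡ toℚ u → ℚ.↧ₙ r ℕD.∣ ℤ.∣ v ∣
  v*r≡u⇒↧ₙr∣∣v∣ u v r@(mkℚ _ _ coprime) v*r≡u =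
    Coprime.coprime-divisor (Coprime.sym (Coprime.recompute coprime))
      (ℕD.divides ℤ.∣ u ∣ (begin
        ℤ.∣ ℚ.↥ r ∣ ℕ.* ℤ.∣ v ∣  ≡⟨ ℤP.abs-* (ℚ.↥ r) v ⟨
        ℤ.∣ ℚ.↥ r ℤ.* v ∣        ≡⟨ cong ℤ.∣_∣ (ℤP.*-comm (ℚ.↥ r) v) ⟩
        ℤ.∣ v ℤ.* ℚ.↥ r ∣        ≡⟨ cong ℤ.∣_∣ (toℚ-injective {u ℤ.* ℚ.↧ r} {v ℤ.* ℚ.↥ r} integral) ⟨
        ℤ.∣ u ℤ.* ℚ.↧ r ∣        ≡⟨ ℤP.abs-* u (ℚ.↧ r) ⟩
        ℤ.∣ u ∣ ℕ.* ℚ.↧ₙ r       ∎))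
    where
    open ≡-Reasoning
    integral : toℚ (u ℤ.* ℚ.↧ r) ≡ toℚ (v ℤ.* ℚ.↥ r)
    integral = begin
      toℚ (u ℤ.* ℚ.↧ r)          ≡⟨ toℚ-* u (ℚ.↧ r) ⟩
      toℚ u * toℚ (ℚ.↧ r)        ≡⟨ cong (_* toℚ (ℚ.↧ r)) v*r≡u ⟨
      toℚ v * r * toℚ (ℚ.↧ r)    ≡⟨ ℚP.*-assoc (toℚ v) r _ ⟩
      toℚ v * (r * toℚ (ℚ.↧ r))  ≡⟨ cong (toℚ v *_) (*-toℚ-↧≡toℚ-↥ r) ⟩
      toℚ v * toℚ (ℚ.↥ r)        ≡⟨ toℚ-* v (ℚ.↥ r) ⟨
      toℚ (v ℤ.* ℚ.↥ r)          ∎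

  AbsLe-integral : ∀ p {x y} (u v : ℤ) → ¬ (p ℕD.∣ ℤ.∣ v ∣) → toℚ v * x ≡ toℚ u * y → AbsLe p x y
  AbsLe-integral p {x} {y} u v p∤v v*x≡u*y =
    z , (λ p∣↧z → p∤v (ℕD.∣-trans p∣↧z (v*r≡u⇒↧ₙr∣∣v∣ u v z v*z≡u))) ,
    *-cancelˡ-≢0 v≢0 (begin
      toℚ v * x        ≡⟨ v*x≡u*y ⟩
      toℚ u * y        ≡⟨ cong (_* y) v*z≡u ⟨
      toℚ v * z * y    ≡⟨ ℚP.*-assoc (toℚ v) z y ⟩
      toℚ v * (z * y)  ∎)
    where
    open ≡-Reasoning
    v≢0 : toℚ v ≢ 0ℚ
    v≢0 v≡0 = p∤v (subst (λ w → p ℕD.∣ ℤ.∣ w ∣) (sym (toℚ-injective {v} {+ 0} v≡0)) (ℕD._∣0 p))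
    instance _ = ℚ.≢-nonZero v≢0
    z = toℚ u * ℚ.1/ toℚ v
    v*z≡u : toℚ v * z ≡ toℚ u
    v*z≡u = begin
      toℚ v * (toℚ u * ℚ.1/ toℚ v)  ≡⟨ swap (toℚ v) (toℚ u) (ℚ.1/ toℚ v) ⟩
      toℚ u * (toℚ v * ℚ.1/ toℚ v)  ≡⟨ cong (toℚ u *_) (ℚP.*-inverseʳ (toℚ v)) ⟩
      toℚ u * 1ℚ                    ≡⟨ ℚP.*-identityʳ (toℚ u) ⟩
      toℚ u                         ∎
      where
      swap : ∀ a b c → a * (b * c) ≡ b * (a * c)
      swap = solve-∀ ℚ-ring

  AbsLe-refl : ∀ {p} → Prime p → ∀ x → AbsLe p x x
  AbsLe-refl p-prime x = AbsLe-integral _ (+ 1) (+ 1) (prime∤1 p-prime) refl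

  z*p≡±1⇒p∣↧ₙz : ∀ p z (u : ℤ) → ℤ.∣ u ∣ ≡ 1 → z * toℚ (+ p) ≡ toℚ u → p ℕD.∣ ℚ.↧ₙ z
  z*p≡±1⇒p∣↧ₙz p z u ∣u∣≡1 z*p≡u = ℕD.divides ℤ.∣ ℚ.↥ z ∣ (begin
    ℚ.↧ₙ z                    ≡⟨ ℕP.*-identityˡ (ℚ.↧ₙ z) ⟨
    1 ℕ.* ℚ.↧ₙ z              ≡⟨ cong (ℕ._* ℚ.↧ₙ z) ∣u∣≡1 ⟨
    ℤ.∣ u ∣ ℕ.* ℚ.↧ₙ z        ≡⟨ ℤP.abs-* u (ℚ.↧ z) ⟨
    ℤ.∣ u ℤ.* ℚ.↧ z ∣         ≡⟨ cong ℤ.∣_∣ (toℚ-injective {ℚ.↥ z ℤ.* + p} {u ℤ.* ℚ.↧ z} integral) ⟨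
    ℤ.∣ ℚ.↥ z ℤ.* + p ∣       ≡⟨ ℤP.abs-* (ℚ.↥ z) (+ p) ⟩
    ℤ.∣ ℚ.↥ z ∣ ℕ.* p         ∎)
    where
    open ≡-Reasoning
    integral : toℚ (ℚ.↥ z ℤ.* + p) ≡ toℚ (u ℤ.* ℚ.↧ z)
    integral = begin
      toℚ (ℚ.↥ z ℤ.* + p)          ≡⟨ toℚ-* (ℚ.↥ z) (+ p) ⟩
      toℚ (ℚ.↥ z) * toℚ (+ p)      ≡⟨ cong (_* toℚ (+ p)) (*-toℚ-↧≡toℚ-↥ z) ⟨
      z * toℚ (ℚ.↧ z) * toℚ (+ p)  ≡⟨ swap z (toℚ (ℚ.↧ z)) (toℚ (+ p)) ⟩
      z * toℚ (+ p) * toℚ (ℚ.↧ z)  ≡⟨ cong (_* toℚ (ℚ.↧ z)) z*p≡u ⟩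
      toℚ u * toℚ (ℚ.↧ z)          ≡⟨ toℚ-* u (ℚ.↧ z) ⟨
      toℚ (u ℤ.* ℚ.↧ z)            ∎
      where
      swap : ∀ a b c → a * b * c ≡ a * c * b
      swap = solve-∀ ℚ-ring

  module ConstantContinuedFraction
    {p : ℕ} (p-prime : Prime p) (q : ℕ) (c : ℤ) (p∣q : p ℕD.∣ q) (p∤c : ¬ (p ℕD.∣ ℤ.∣ c ∣))
    (a : ℚ) (a*q≡c : a * toℚ (+ q) ≡ toℚ c) where

    open ≡-Reasoning

    A B : ℕ → ℚ
    A = contA (λ _ → a)
    B = contB (λ _ → a)

    q^ : ℕ → ℚ
    q^ n = toℚ (+ (q ℕ.^ n))

    q^-suc : ∀ n → q^ (suc n) ≡ toℚ (+ q) * q^ n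
    q^-suc n = toℚ-pos-* q (q ℕ.^ n)

    qq : ℤ
    qq = + q ℤ.* + q

    -- Since a q = c, the scaled convergents q ^ n A n and q ^ n B n satisfy this recurrence over ℤ.
    scaled : ℤ → ℤ → ℕ → ℤ
    scaled x₀ x₁ zero          = x₀
    scaled x₀ x₁ (suc zero)    = x₁
    scaled x₀ x₁ (suc (suc n)) = c ℤ.* scaled x₀ x₁ (suc n) ℤ.+ qq ℤ.* scaled x₀ x₁ n

    Â B̂ : ℕ → ℤ
    Â = scaled (+ 1) c
    B̂ = scaled (+ 0) (+ q)

    scaled-step : ∀ n {X₁ X₀ Y₁ Y₀} → X₁ * q^ (suc n) ≡ toℚ Y₁ → X₀ * q^ n ≡ toℚ Y₀ →
                  (a * X₁ + X₀) * q^ (suc (suc n)) ≡ toℚ (c ℤ.* Y₁ ℤ.+ qq ℤ.* Y₀)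
    scaled-step n {X₁} {X₀} {Y₁} {Y₀} eq₁ eq₀ = begin
      (a * X₁ + X₀) * q^ (suc (suc n))
        ≡⟨ cong ((a * X₁ + X₀) *_) (trans (q^-suc (suc n)) (cong (Q *_) (q^-suc n))) ⟩
      (a * X₁ + X₀) * (Q * (Q * q^ n))
        ≡⟨ distribute a X₁ X₀ Q (q^ n) ⟩
      (a * Q) * (X₁ * (Q * q^ n)) + (Q * Q) * (X₀ * q^ n)
        ≡⟨ cong₂ (λ s t → (a * Q) * s + (Q * Q) * t) (trans (cong (X₁ *_) (sym (q^-suc n))) eq₁) eq₀ ⟩
      (a * Q) * toℚ Y₁ + (Q * Q) * toℚ Y₀
        ≡⟨ cong₂ (λ s t → s * toℚ Y₁ + t * toℚ Y₀) a*q≡c (sym (toℚ-* (+ q) (+ q))) ⟩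
      toℚ c * toℚ Y₁ + toℚ qq * toℚ Y₀
        ≡⟨ cong₂ _+_ (toℚ-* c Y₁) (toℚ-* qq Y₀) ⟨
      toℚ (c ℤ.* Y₁) + toℚ (qq ℤ.* Y₀)
        ≡⟨ toℚ-+ (c ℤ.* Y₁) (qq ℤ.* Y₀) ⟨
      toℚ (c ℤ.* Y₁ ℤ.+ qq ℤ.* Y₀) ∎
      where
      Q = toℚ (+ q)
      distribute : ∀ a x y Q R → (a * x + y) * (Q * (Q * R)) ≡ (a * Q) * (x * (Q * R)) + (Q * Q) * (y * R)
      distribute = solve-∀ ℚ-ring

    A-scaled : ∀ n → A n * q^ n ≡ toℚ (Â n)
    A-scaled zero          = refl
    A-scaled (suc zero)    = trans (cong (a *_) (cong toℚ (cong +_ (ℕP.*-identityʳ q)))) a*q≡c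
    A-scaled (suc (suc n)) = scaled-step n (A-scaled (suc n)) (A-scaled n)

    B-scaled : ∀ n → B n * q^ n ≡ toℚ (B̂ n)
    B-scaled zero          = refl
    B-scaled (suc zero)    = trans (ℚP.*-identityˡ (q^ 1)) (cong toℚ (cong +_ (ℕP.*-identityʳ q)))
    B-scaled (suc (suc n)) = scaled-step n (B-scaled (suc n)) (B-scaled n)

    det : ℕ → ℕ → ℤ
    det m n = Â m ℤ.* B̂ n ℤ.- B̂ m ℤ.* Â n

    q^n∣det[1+n,n] : ∀ n → + (q ℕ.^ n) ℤD.∣ det (suc n) n
    q^n∣det[1+n,n] zero    = ℤD.∣ᵤ⇒∣ (ℕD.1∣ _)
    q^n∣det[1+n,n] (suc n) = subst₂ ℤD._∣_ (sym (ℤP.pos-* q (q ℕ.^ n))) (sym (recurrence c (+ q) _ _ _ _))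
      (ℤD.∣n⇒∣m*n (ℤ.- + q) (ℤD.*-monoʳ-∣ (+ q) (q^n∣det[1+n,n] n)))
      where
      recurrence : ∀ c q a₁ a₀ b₁ b₀ →
        (c ℤ.* a₁ ℤ.+ q ℤ.* q ℤ.* a₀) ℤ.* b₁ ℤ.- (c ℤ.* b₁ ℤ.+ q ℤ.* q ℤ.* b₀) ℤ.* a₁
          ≡ ℤ.- q ℤ.* (q ℤ.* (a₁ ℤ.* b₀ ℤ.- b₁ ℤ.* a₀))
      recurrence = ℤ-Solver.solve-∀

    q^n∣det : ∀ j n → + (q ℕ.^ n) ℤD.∣ det (j ℕ.+ n) n
    q^n∣det zero          n = subst (_ ℤD.∣_) (sym (antisymmetric (Â n) (B̂ n))) (ℤD.divides (+ 0) refl)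
      where
      antisymmetric : ∀ x y → x ℤ.* y ℤ.- y ℤ.* x ≡ + 0
      antisymmetric = ℤ-Solver.solve-∀
    q^n∣det (suc zero)    n = q^n∣det[1+n,n] n
    q^n∣det (suc (suc j)) n = subst (_ ℤD.∣_) (sym (recurrence c qq _ _ _ _ (Â n) (B̂ n)))
      (ℤD.∣m∣n⇒∣m+n (ℤD.∣n⇒∣m*n c (q^n∣det (suc j) n)) (ℤD.∣n⇒∣m*n qq (q^n∣det j n)))
      where
      recurrence : ∀ c Q a₁ a₀ b₁ b₀ x y →
        (c ℤ.* a₁ ℤ.+ Q ℤ.* a₀) ℤ.* y ℤ.- (c ℤ.* b₁ ℤ.+ Q ℤ.* b₀) ℤ.* x
          ≡ c ℤ.* (a₁ ℤ.* y ℤ.- b₁ ℤ.* x) ℤ.+ Q ℤ.* (a₀ ℤ.* y ℤ.- b₀ ℤ.* x)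
      recurrence = ℤ-Solver.solve-∀

    p^k∣det-≥ : ∀ {k m n} → k ℕ.≤ n → n ℕ.≤ m → + (p ℕ.^ k) ℤD.∣ det m n
    p^k∣det-≥ {k} {m} {n} k≤n n≤m =
      ℤD.∣-trans p^k∣q^n (subst (λ j → _ ℤD.∣ det j n) (ℕP.m∸n+n≡m n≤m) (q^n∣det (m ℕ.∸ n) n))
      where
      p^k∣q^n : + (p ℕ.^ k) ℤD.∣ + (q ℕ.^ n)
      p^k∣q^n = ℤD.∣ᵤ⇒∣ (ℕD.∣-trans (^-monoʳ-∣ p k≤n) (^-monoˡ-∣ n p∣q))

    p^k∣det : ∀ {k m n} → k ℕ.≤ m → k ℕ.≤ n → + (p ℕ.^ k) ℤD.∣ det m n
    p^k∣det {k} {m} {n} k≤m k≤n with ℕP.≤-total n m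
    ... | inj₁ n≤m = p^k∣det-≥ k≤n n≤m
    ... | inj₂ m≤n = subst (_ ℤD.∣_) (antisymmetric (Â m) (B̂ m) (Â n) (B̂ n)) (ℤD.∣m⇒∣-m (p^k∣det-≥ k≤m m≤n))
      where
      antisymmetric : ∀ a b x y → ℤ.- (x ℤ.* b ℤ.- y ℤ.* a) ≡ a ℤ.* y ℤ.- b ℤ.* x
      antisymmetric = ℤ-Solver.solve-∀

    p∤Â : ∀ n → ¬ (p ℕD.∣ ℤ.∣ Â n ∣)
    p∤Â zero          = prime∤1 p-prime
    p∤Â (suc zero)    = p∤c
    p∤Â (suc (suc n)) p∣Â =
      prime∤* p-prime p∤c (p∤Â (suc n)) (subst (p ℕD.∣_) (ℤP.abs-* c (Â (suc n))) (ℤD.∣⇒∣ᵤ p∣cÂ))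
      where
      p∣qqÂ : + p ℤD.∣ qq ℤ.* Â n
      p∣qqÂ = ℤD.∣m⇒∣m*n (Â n) (ℤD.∣m⇒∣m*n {+ p} {+ q} (+ q) (ℤD.∣ᵤ⇒∣ p∣q))
      p∣cÂ : + p ℤD.∣ c ℤ.* Â (suc n)
      p∣cÂ = ℤD.∣m+n∣n⇒∣m (ℤD.∣ᵤ⇒∣ {+ p} {Â (suc (suc n))} p∣Â) p∣qqÂ

    AbsLe-B-A : ∀ n → AbsLe p (B n) (A n)
    AbsLe-B-A n = AbsLe-integral p (B̂ n) (Â n) (p∤Â n) (begin
      toℚ (Â n) * B n        ≡⟨ cong (_* B n) (A-scaled n) ⟨
      A n * q^ n * B n       ≡⟨ swap (A n) (q^ n) (B n) ⟩
      B n * q^ n * A n       ≡⟨ cong (_* A n) (B-scaled n) ⟩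
      toℚ (B̂ n) * A n        ∎)
      where
      swap : ∀ x y z → x * y * z ≡ z * y * x
      swap = solve-∀ ℚ-ring

    A-isMaxAbs : ∀ n → IsMaxAbs p (A n) (B n) (A n)
    A-isMaxAbs n = inj₁ refl , AbsLe-refl p-prime (A n) , AbsLe-B-A n

    det-scaled : ∀ m n → toℚ (det m n) ≡ q^ m * q^ n * (A m * B n - B m * A n)
    det-scaled m n = begin
      toℚ (Â m ℤ.* B̂ n ℤ.- B̂ m ℤ.* Â n)
        ≡⟨ toℚ-- (Â m ℤ.* B̂ n) (B̂ m ℤ.* Â n) ⟩
      toℚ (Â m ℤ.* B̂ n) - toℚ (B̂ m ℤ.* Â n)
        ≡⟨ cong₂ _-_ (toℚ-* (Â m) (B̂ n)) (toℚ-* (B̂ m) (Â n)) ⟩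
      toℚ (Â m) * toℚ (B̂ n) - toℚ (B̂ m) * toℚ (Â n)
        ≡⟨ cong₂ _-_ (cong₂ _*_ (A-scaled m) (B-scaled n)) (cong₂ _*_ (B-scaled m) (A-scaled n)) ⟨
      (A m * q^ m) * (B n * q^ n) - (B m * q^ m) * (A n * q^ n)
        ≡⟨ regroup (A m) (B m) (A n) (B n) (q^ m) (q^ n) ⟩
      q^ m * q^ n * (A m * B n - B m * A n) ∎
      where
      regroup : ∀ a b x y Q R → (a * Q) * (y * R) - (b * Q) * (x * R) ≡ Q * R * (a * y - b * x)
      regroup = solve-∀ ℚ-ring

    chordal-A-B : ∀ {k m n} → k ℕ.≤ m → k ℕ.≤ n →
      AbsLe p (A m * B n - B m * A n) (pPow p k * A m * A n)
    chordal-A-B {k} {m} {n} k≤m k≤n with p^k∣det k≤m k≤n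
    ... | ℤD.divides e det≡e*p^k = AbsLe-integral p e (Â m ℤ.* Â n)
      (prime∤* p-prime (p∤Â m) (p∤Â n) ∘ subst (p ℕD.∣_) (ℤP.abs-* (Â m) (Â n))) (begin
        toℚ (Â m ℤ.* Â n) * X                ≡⟨ cong (_* X) (toℚ-* (Â m) (Â n)) ⟩
        toℚ (Â m) * toℚ (Â n) * X            ≡⟨ cong₂ (λ s t → s * t * X) (A-scaled m) (A-scaled n) ⟨
        A m * q^ m * (A n * q^ n) * X        ≡⟨ regroup (A m) (A n) (q^ m) (q^ n) X ⟩
        A m * A n * (q^ m * q^ n * X)        ≡⟨ cong (A m * A n *_) (det-scaled m n) ⟨
        A m * A n * toℚ (det m n)            ≡⟨ cong (λ d → A m * A n * toℚ d) det≡e*p^k ⟩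
        A m * A n * toℚ (e ℤ.* + (p ℕ.^ k))  ≡⟨ cong (A m * A n *_) (toℚ-* e (+ (p ℕ.^ k))) ⟩
        A m * A n * (toℚ e * pPow p k)       ≡⟨ regroup′ (A m) (A n) (toℚ e) (pPow p k) ⟩
        toℚ e * (pPow p k * A m * A n)       ∎)
      where
      X = A m * B n - B m * A n
      regroup : ∀ a x Q R X → a * Q * (x * R) * X ≡ a * x * (Q * R * X)
      regroup = solve-∀ ℚ-ring
      regroup′ : ∀ a x e P → a * x * (e * P) ≡ e * (P * a * x)
      regroup′ = solve-∀ ℚ-ring

    converges : PAdicConverges p (λ _ → a)
    converges k = k , λ m n k≤m k≤n → A m , A n , A-isMaxAbs m , A-isMaxAbs n , chordal-A-B k≤m k≤n

  zero-convergent-suc-suc : ∀ n → convergent (λ _ → 0ℚ) (suc (suc n)) ≡ convergent (λ _ → 0ℚ) n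
  zero-convergent-suc-suc n = cong₂ _,_ (0*x+y≡y (contA _ (suc n)) (contA _ n)) (0*x+y≡y (contB _ (suc n)) (contB _ n))
    where
    0*x+y≡y : ∀ x y → 0ℚ * x + y ≡ y
    0*x+y≡y = solve-∀ ℚ-ring

  zero-convergents : ∀ n →
    (convergent (λ _ → 0ℚ) n ≡ (1ℚ , 0ℚ) × convergent (λ _ → 0ℚ) (suc n) ≡ (0ℚ , 1ℚ)) ⊎
    (convergent (λ _ → 0ℚ) n ≡ (0ℚ , 1ℚ) × convergent (λ _ → 0ℚ) (suc n) ≡ (1ℚ , 0ℚ))
  zero-convergents zero = inj₁ (refl , refl)
  zero-convergents (suc n) with zero-convergents n
  ... | inj₁ (even , odd) = inj₂ (odd , trans (zero-convergent-suc-suc n) even)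
  ... | inj₂ (even , odd) = inj₁ (odd , trans (zero-convergent-suc-suc n) even)

  1≢x*0 : ∀ {x} → 1ℚ ≢ x * 0ℚ
  1≢x*0 {x} eq with trans eq (ℚP.*-zeroʳ x)
  ... | ()

  pPow[1]*1*1 : ∀ p → pPow p 1 * 1ℚ * 1ℚ ≡ toℚ (+ p)
  pPow[1]*1*1 p = trans (ℚP.*-identityʳ _) (trans (ℚP.*-identityʳ _) (cong (λ m → toℚ (+ m)) (ℕP.*-identityʳ p)))

  ¬ChordalLe[∞,0] : ∀ {p} → ¬ ChordalLe p 1 (1ℚ , 0ℚ) (0ℚ , 1ℚ)
  ¬ChordalLe[∞,0] (_ , _ , (inj₂ refl , (z , _ , 1≡z*0) , _) , _) = 1≢x*0 {z} 1≡z*0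
  ¬ChordalLe[∞,0] (_ , _ , _ , (inj₁ refl , _ , (z , _ , 1≡z*0)) , _) = 1≢x*0 {z} 1≡z*0
  ¬ChordalLe[∞,0] {p} (_ , _ , (inj₁ refl , _) , (inj₂ refl , _) , (z , z∈ℤₚ , 1≡z*p)) =
    z∈ℤₚ (z*p≡±1⇒p∣↧ₙz p z (+ 1) refl (sym (trans 1≡z*p (cong (z *_) (pPow[1]*1*1 p)))))

  ¬ChordalLe[0,∞] : ∀ {p} → ¬ ChordalLe p 1 (0ℚ , 1ℚ) (1ℚ , 0ℚ)
  ¬ChordalLe[0,∞] (_ , _ , (inj₁ refl , _ , (z , _ , 1≡z*0)) , _) = 1≢x*0 {z} 1≡z*0
  ¬ChordalLe[0,∞] (_ , _ , _ , (inj₂ refl , (z , _ , 1≡z*0) , _) , _) = 1≢x*0 {z} 1≡z*0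
  ¬ChordalLe[0,∞] {p} (_ , _ , (inj₂ refl , _) , (inj₁ refl , _) , (z , z∈ℤₚ , -1≡z*p)) =
    z∈ℤₚ (z*p≡±1⇒p∣↧ₙz p z -[1+ 0 ] refl (sym (trans -1≡z*p (cong (z *_) (pPow[1]*1*1 p)))))

  zero-diverges : ∀ {p} → ¬ PAdicConverges p (λ _ → 0ℚ)
  zero-diverges converges with converges 1
  ... | N , cauchy with zero-convergents N | cauchy N (suc N) ℕP.≤-refl (ℕP.n≤1+n N)
  ... | inj₁ (even , odd) | close = ¬ChordalLe[∞,0] (subst₂ (ChordalLe _ 1) even odd close)
  ... | inj₂ (even , odd) | close = ¬ChordalLe[0,∞] (subst₂ (ChordalLe _ 1) even odd close)

  n*[1/n]≡1 : ∀ n .{{_ : ℕ.NonZero n}} → toℚ (+ n) * (+ 1 ℚ./ n) ≡ 1ℚ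
  n*[1/n]≡1 (suc m) = ℚP.toℚᵘ-injective (begin-equality
    toℚᵘ (toℚ (+ suc m) * (+ 1 ℚ./ suc m))            ≃⟨ ℚP.toℚᵘ-homo-* (toℚ (+ suc m)) (+ 1 ℚ./ suc m) ⟩
    toℚᵘ (toℚ (+ suc m)) ℚᵘ.* toℚᵘ (+ 1 ℚ./ suc m)
      ≃⟨ ℚᵘP.*-cong (toℚᵘ-toℚ (+ suc m)) (ℚP.toℚᵘ-fromℚᵘ (mkℚᵘ (+ 1) m)) ⟩
    mkℚᵘ (+ suc m) 0 ℚᵘ.* mkℚᵘ (+ 1) m                ≃⟨ *≡* (cancel (+ suc m)) ⟩
    ℚᵘ.1ℚᵘ                                            ∎)
    where
    open ℚᵘP.≤-Reasoning
    cancel : ∀ x → x ℤ.* + 1 ℤ.* + 1 ≡ + 1 ℤ.* (+ 1 ℤ.* x)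
    cancel = ℤ-Solver.solve-∀

  pPow*invPow : ∀ {p} → Prime p → ∀ α → pPow p α * invPow p α ≡ 1ℚ
  pPow*invPow {suc p} _ α = n*[1/n]≡1 (suc p ℕ.^ α) {{ℕP.m^n≢0 (suc p) α}}

  pPow-+ : ∀ p m n → pPow p (m ℕ.+ n) ≡ pPow p m * pPow p n
  pPow-+ p m n = trans (cong (λ k → toℚ (+ k)) (ℕP.^-distribˡ-+-* p m n)) (toℚ-pos-* (p ℕ.^ m) (p ℕ.^ n))

  pPow-2* : ∀ p α → pPow p (2 ℕ.* α) ≡ pPow p α * pPow p α
  pPow-2* p α = trans (cong (λ k → pPow p (α ℕ.+ k)) (ℕP.+-identityʳ α)) (pPow-+ p α α)

  IsSign⇒ε*ε≡1 : ∀ {ε} → IsSign ε → ε * ε ≡ 1ℚ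
  IsSign⇒ε*ε≡1 (inj₁ refl) = refl
  IsSign⇒ε*ε≡1 (inj₂ refl) = refl

  IsSign-neg : ∀ {ε} → IsSign ε → IsSign (- ε)
  IsSign-neg (inj₁ refl) = inj₂ refl
  IsSign-neg (inj₂ refl) = inj₁ refl

  IsSign⇒unit : ∀ {ε} → IsSign ε → ∃ λ s → ℤ.∣ s ∣ ≡ 1 × toℚ s ≡ ε
  IsSign⇒unit (inj₁ refl) = + 1 , refl , refl
  IsSign⇒unit (inj₂ refl) = -[1+ 0 ] , refl , refl

  a⋆ : ℕ → ℕ → ℚ → ℚ
  a⋆ p α ε = ε * ((1ℚ - pPow p (2 ℕ.* α)) * invPow p α)

  a⋆[0]≡0 : ∀ p ε → a⋆ p 0 ε ≡ 0ℚ
  a⋆[0]≡0 p ε = trans (cong (ε *_) (ℚP.*-zeroˡ (invPow p 0))) (ℚP.*-zeroʳ ε)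

  a⋆-sum : ∀ {p} → Prime p → ∀ α ε → ε * invPow p α + - (ε * pPow p α) ≡ a⋆ p α ε
  a⋆-sum {p} p-prime α ε = sym (begin
    a⋆ p α ε                       ≡⟨ cong (λ t → ε * ((1ℚ - t) * w)) (pPow-2* p α) ⟩
    ε * ((1ℚ - Q * Q) * w)         ≡⟨ expand ε Q w ⟩
    ε * w - ε * Q * (Q * w)        ≡⟨ cong (λ t → ε * w - ε * Q * t) (pPow*invPow p-prime α) ⟩
    ε * w - ε * Q * 1ℚ             ≡⟨ cong (λ t → ε * w - t) (ℚP.*-identityʳ (ε * Q)) ⟩
    ε * w - ε * Q                  ∎)
    where
    open ≡-Reasoning
    Q = pPow p α
    w = invPow p α
    expand : ∀ e Q w → e * ((1ℚ - Q * Q) * w) ≡ e * w - e * Q * (Q * w)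
    expand = solve-∀ ℚ-ring

  a⋆-product : ∀ {p} → Prime p → ∀ α {ε} → IsSign ε → ε * invPow p α * - (ε * pPow p α) ≡ - 1ℚ
  a⋆-product {p} p-prime α {ε} ε-sign = begin
    ε * w * - (ε * Q)        ≡⟨ regroup ε Q w ⟩
    - ((ε * ε) * (Q * w))    ≡⟨ cong₂ (λ s t → - (s * t)) (IsSign⇒ε*ε≡1 ε-sign) (pPow*invPow p-prime α) ⟩
    - 1ℚ                     ∎
    where
    open ≡-Reasoning
    Q = pPow p α
    w = invPow p α
    regroup : ∀ e Q w → e * w * - (e * Q) ≡ - ((e * e) * (Q * w))
    regroup = solve-∀ ℚ-ring

  InV⇒ : ∀ {A B C a} → InV A B C a → B ≡ - (A * a) × C ≡ - A
  InV⇒ {A} {B} {C} {a} (eq₁ , eq₂ , _) =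
    trans (sym (ℚP.*-identityʳ B)) (trans (sym eq₁) (A*[0-a]≡-[A*a] A a)) ,
    trans (sym (ℚP.*-identityʳ C)) (trans (sym eq₂) (cong -_ (ℚP.*-identityʳ A)))
    where
    A*[0-a]≡-[A*a] : ∀ A a → A * (0ℚ - a) ≡ - (A * a)
    A*[0-a]≡-[A*a] = solve-∀ ℚ-ring

  ⇒InV : ∀ {A B C a} → B ≡ - (A * a) → C ≡ - A → InV A B C a
  ⇒InV {A} {a = a} refl refl = eq₁ A a , eq₂ A , eq₃ A a
    where
    eq₁ : ∀ A a → A * (0ℚ - a) ≡ - (A * a) * 1ℚ
    eq₁ = solve-∀ ℚ-ring
    eq₂ : ∀ A → - (A * 1ℚ) ≡ - A * 1ℚ
    eq₂ = solve-∀ ℚ-ring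
    eq₃ : ∀ A a → - (- (A * a) * 1ℚ) ≡ - A * (0ℚ - a)
    eq₃ = solve-∀ ℚ-ring

  InV⇒A≢0 : ∀ {A B C a} → NonzeroPoly A B C → InV A B C a → A ≢ 0ℚ
  InV⇒A≢0 {A} {B} {C} {a} F≢0 a∈V A≡0 = F≢0 (A≡0 , B≡0 , C≡0)
    where
    open ≡-Reasoning
    B≡0 : B ≡ 0ℚ
    B≡0 = begin
      B            ≡⟨ proj₁ (InV⇒ {A} {B} {C} {a} a∈V) ⟩
      - (A * a)    ≡⟨ cong (λ t → - (t * a)) A≡0 ⟩
      - (0ℚ * a)   ≡⟨ cong -_ (ℚP.*-zeroˡ a) ⟩
      0ℚ           ∎
    C≡0 : C ≡ 0ℚ
    C≡0 = trans (proj₂ (InV⇒ {A} {B} {C} {a} a∈V)) (cong -_ A≡0)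

  InV-unique : ∀ {A B C a b} → A ≢ 0ℚ → InV A B C a → InV A B C b → a ≡ b
  InV-unique {A} {B} {C} {a} {b} A≢0 a∈V b∈V =
    *-cancelˡ-≢0 A≢0 (ℚP.neg-injective (trans (sym (proj₁ (InV⇒ {A} {B} {C} {a} a∈V)))
                                              (proj₁ (InV⇒ {A} {B} {C} {b} b∈V))))

  RootsAre⇒InV : ∀ {A B C x₁ x₂} → x₁ * x₂ ≡ - 1ℚ → RootsAre A B C x₁ x₂ → A ≢ 0ℚ × InV A B C (x₁ + x₂)
  RootsAre⇒InV {A} x₁x₂≡-1 (A≢0 , B≡-A[x₁+x₂] , C≡Ax₁x₂) =
    A≢0 , ⇒InV B≡-A[x₁+x₂] (trans C≡Ax₁x₂ (trans (cong (A *_) x₁x₂≡-1) (A*-1≡-A A)))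
    where
    A*-1≡-A : ∀ A → A * - 1ℚ ≡ - A
    A*-1≡-A = solve-∀ ℚ-ring

  InV⇒RootsAre : ∀ {A B C x₁ x₂} → x₁ * x₂ ≡ - 1ℚ → A ≢ 0ℚ → InV A B C (x₁ + x₂) → RootsAre A B C x₁ x₂
  InV⇒RootsAre {A} {B} {C} {x₁} {x₂} x₁x₂≡-1 A≢0 s∈V =
    A≢0 , proj₁ (InV⇒ {A} {B} {C} {x₁ + x₂} s∈V) , C≡Ax₁x₂
    where
    A*-1≡-A : ∀ A → A * - 1ℚ ≡ - A
    A*-1≡-A = solve-∀ ℚ-ring
    C≡Ax₁x₂ : C ≡ A * (x₁ * x₂)
    C≡Ax₁x₂ = begin
      C                ≡⟨ proj₂ (InV⇒ {A} {B} {C} {x₁ + x₂} s∈V) ⟩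
      - A              ≡⟨ A*-1≡-A A ⟨
      A * - 1ℚ         ≡⟨ cong (A *_) x₁x₂≡-1 ⟨
      A * (x₁ * x₂)    ∎
      where open ≡-Reasoning

  Vieta-root : ∀ {x₁ x₂} → x₁ * x₂ ≡ - 1ℚ → x₁ * x₁ ≡ (x₁ + x₂) * x₁ + 1ℚ
  Vieta-root {x₁} {x₂} x₁x₂≡-1 = begin
    x₁ * x₁                            ≡⟨ expand x₁ x₂ ⟩
    (x₁ + x₂) * x₁ - x₁ * x₂           ≡⟨ cong (λ t → (x₁ + x₂) * x₁ - t) x₁x₂≡-1 ⟩
    (x₁ + x₂) * x₁ + 1ℚ                ∎
    where
    open ≡-Reasoning
    expand : ∀ x y → x * x ≡ (x + y) * x - x * y
    expand = solve-∀ ℚ-ring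

  same-root⇒≡ : ∀ {x a b} → x * x ≡ a * x + 1ℚ → x * x ≡ b * x + 1ℚ → a ≡ b
  same-root⇒≡ {x} {a} {b} root-a root-b = *-cancelʳ-≢0 x≢0 (+-cancelʳ 1ℚ (a * x) (b * x) (trans (sym root-a) root-b))
    where
    x≢0 : x ≢ 0ℚ
    x≢0 refl with trans root-a (cong (_+ 1ℚ) (ℚP.*-zeroʳ a))
    ... | ()

  Reducible⇒root : ∀ {A B C} → A ≢ 0ℚ → Reducible A B C → ∃ λ x → A * (x * x) + B * x + C ≡ 0ℚ
  Reducible⇒root {A} {B} {C} A≢0 (r , s , t , u , A≡rt , B≡ru+st , C≡su) = x , (begin
    A * (x * x) + B * x + C      ≡⟨ factor A≡rt B≡ru+st C≡su ⟩
    (r * x + s) * (t * x + u)    ≡⟨ cong (_* (t * x + u)) r*x+s≡0 ⟩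
    0ℚ * (t * x + u)             ≡⟨ ℚP.*-zeroˡ (t * x + u) ⟩
    0ℚ                           ∎)
    where
    open ≡-Reasoning
    r≢0 : r ≢ 0ℚ
    r≢0 r≡0 = A≢0 (trans A≡rt (trans (cong (_* t) r≡0) (ℚP.*-zeroˡ t)))
    instance _ = ℚ.≢-nonZero r≢0
    x = - (s * ℚ.1/ r)
    r*x+s≡0 : r * x + s ≡ 0ℚ
    r*x+s≡0 = begin
      r * - (s * ℚ.1/ r) + s       ≡⟨ regroup r s (ℚ.1/ r) ⟩
      s - s * (r * ℚ.1/ r)         ≡⟨ cong (λ t → s - s * t) (ℚP.*-inverseʳ r) ⟩
      s - s * 1ℚ                   ≡⟨ cancel s ⟩
      0ℚ                           ∎
      where
      regroup : ∀ r s i → r * - (s * i) + s ≡ s - s * (r * i)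
      regroup = solve-∀ ℚ-ring
      cancel : ∀ s → s - s * 1ℚ ≡ 0ℚ
      cancel = solve-∀ ℚ-ring
    factor : ∀ {A B C} → A ≡ r * t → B ≡ r * u + s * t → C ≡ s * u →
             A * (x * x) + B * x + C ≡ (r * x + s) * (t * x + u)
    factor refl refl refl = expand r s t u x
      where
      expand : ∀ r s t u x → r * t * (x * x) + (r * u + s * t) * x + s * u ≡ (r * x + s) * (t * x + u)
      expand = solve-∀ ℚ-ring

  InV∧root⇒root : ∀ {A B C a x} → A ≢ 0ℚ → InV A B C a → A * (x * x) + B * x + C ≡ 0ℚ → x * x ≡ a * x + 1ℚ
  InV∧root⇒root {A} {B} {C} {a} {x} A≢0 a∈V F[x]≡0 = begin
    x * x                                  ≡⟨ shift x a ⟩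
    (x * x - a * x - 1ℚ) + (a * x + 1ℚ)    ≡⟨ cong (_+ (a * x + 1ℚ)) G[x]≡0 ⟩
    0ℚ + (a * x + 1ℚ)                      ≡⟨ ℚP.+-identityˡ (a * x + 1ℚ) ⟩
    a * x + 1ℚ                             ∎
    where
    open ≡-Reasoning
    shift : ∀ x a → x * x ≡ (x * x - a * x - 1ℚ) + (a * x + 1ℚ)
    shift = solve-∀ ℚ-ring
    expand : ∀ A a x → A * (x * x - a * x - 1ℚ) ≡ A * (x * x) + - (A * a) * x + - A
    expand = solve-∀ ℚ-ring
    B≡-Aa : B ≡ - (A * a)
    B≡-Aa = proj₁ (InV⇒ {A} {B} {C} {a} a∈V)
    C≡-A : C ≡ - A
    C≡-A = proj₂ (InV⇒ {A} {B} {C} {a} a∈V)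
    A*G[x]≡A*0 : A * (x * x - a * x - 1ℚ) ≡ A * 0ℚ
    A*G[x]≡A*0 = begin
      A * (x * x - a * x - 1ℚ)             ≡⟨ expand A a x ⟩
      A * (x * x) + - (A * a) * x + - A    ≡⟨ cong₂ (λ b c → A * (x * x) + b * x + c) (sym B≡-Aa) (sym C≡-A) ⟩
      A * (x * x) + B * x + C              ≡⟨ F[x]≡0 ⟩
      0ℚ                                   ≡⟨ ℚP.*-zeroʳ A ⟨
      A * 0ℚ                               ∎
    G[x]≡0 : x * x - a * x - 1ℚ ≡ 0ℚ
    G[x]≡0 = *-cancelˡ-≢0 A≢0 A*G[x]≡A*0

  ∣z∣≡m⇒toℚz≡±m : ∀ z {m} → ℤ.∣ z ∣ ≡ m → ∃ λ ε → IsSign ε × toℚ z ≡ ε * toℚ (+ m)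
  ∣z∣≡m⇒toℚz≡±m (+ n)    refl = 1ℚ , inj₁ refl , sym (ℚP.*-identityˡ (toℚ (+ n)))
  ∣z∣≡m⇒toℚz≡±m -[1+ n ] refl = - 1ℚ , inj₂ refl , trans (toℚ-neg (+ suc n)) (-x≡-1*x (toℚ (+ suc n)))
    where
    -x≡-1*x : ∀ x → - x ≡ - 1ℚ * x
    -x≡-1*x = solve-∀ ℚ-ring

  u≡v*d⇒∣d∣∣∣u∣ : ∀ {d u} v → u ≡ v ℤ.* d → ℤ.∣ d ∣ ℕD.∣ ℤ.∣ u ∣
  u≡v*d⇒∣d∣∣∣u∣ {d} {u} v u≡v*d = ℤD.∣⇒∣ᵤ {d} {u} (ℤD.divides v u≡v*d)

  abs-*-* : ∀ z w → ℤ.∣ z ℤ.* (z ℤ.* w) ∣ ≡ ℤ.∣ z ∣ ℕ.* (ℤ.∣ z ∣ ℕ.* ℤ.∣ w ∣)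
  abs-*-* z w = trans (ℤP.abs-* z (z ℤ.* w)) (cong (ℤ.∣ z ∣ ℕ.*_) (ℤP.abs-* z w))

  clear-denominators : ∀ {a x : ℚ} {n N d P : ℤ} → x * toℚ d ≡ toℚ n → a * toℚ P ≡ toℚ N →
    x * x ≡ a * x + 1ℚ → n ℤ.* (n ℤ.* P) ≡ (N ℤ.* n ℤ.+ d ℤ.* P) ℤ.* d
  clear-denominators {a} {x} {n} {N} {d} {P} x*d≡n a*P≡N x²≡ax+1 = toℚ-injective (begin
    toℚ (n ℤ.* (n ℤ.* P))                      ≡⟨ trans (toℚ-* n (n ℤ.* P)) (cong (toℚ n *_) (toℚ-* n P)) ⟩
    toℚ n * (toℚ n * toℚ P)                    ≡⟨ cong (λ t → t * (t * toℚ P)) x*d≡n ⟨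
    (x * toℚ d) * ((x * toℚ d) * toℚ P)        ≡⟨ regroup x (toℚ d) (toℚ P) ⟩
    (x * x) * (toℚ d * toℚ d * toℚ P)          ≡⟨ cong (_* (toℚ d * toℚ d * toℚ P)) x²≡ax+1 ⟩
    (a * x + 1ℚ) * (toℚ d * toℚ d * toℚ P)     ≡⟨ regroup′ a x (toℚ d) (toℚ P) ⟩
    ((a * toℚ P) * (x * toℚ d) + toℚ d * toℚ P) * toℚ d
                                               ≡⟨ cong₂ (λ s t → (s * t + toℚ d * toℚ P) * toℚ d) a*P≡N x*d≡n ⟩
    (toℚ N * toℚ n + toℚ d * toℚ P) * toℚ d    ≡⟨ cong (_* toℚ d) (cong₂ _+_ (toℚ-* N n) (toℚ-* d P)) ⟨
    (toℚ (N ℤ.* n) + toℚ (d ℤ.* P)) * toℚ d    ≡⟨ cong (_* toℚ d) (toℚ-+ (N ℤ.* n) (d ℤ.* P)) ⟨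
    toℚ (N ℤ.* n ℤ.+ d ℤ.* P) * toℚ d          ≡⟨ toℚ-* (N ℤ.* n ℤ.+ d ℤ.* P) d ⟨
    toℚ ((N ℤ.* n ℤ.+ d ℤ.* P) ℤ.* d)          ∎)
    where
    open ≡-Reasoning
    regroup : ∀ x D P → (x * D) * ((x * D) * P) ≡ (x * x) * (D * D * P)
    regroup = solve-∀ ℚ-ring
    regroup′ : ∀ a x D P → (a * x + 1ℚ) * (D * D * P) ≡ ((a * P) * (x * D) + D * P) * D
    regroup′ = solve-∀ ℚ-ring

  root⇒∣↥∣∣p^k×↧ₙ∣p^k : ∀ {p k a x} → ℚ.↧ₙ a ≡ p ℕ.^ k → x * x ≡ a * x + 1ℚ →
    ℤ.∣ ℚ.↥ x ∣ ℕD.∣ p ℕ.^ k × ℚ.↧ₙ x ℕD.∣ p ℕ.^ k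
  root⇒∣↥∣∣p^k×↧ₙ∣p^k {p} {k} {a} {x@(mkℚ n d-1 n⊥d)} ↧a≡p^k x²≡ax+1 =
    Coprime.coprime-divisor n⊥d′ (Coprime.coprime-divisor n⊥d′
      (subst (ℤ.∣ n ∣ ℕD.∣_) (abs-*-* (+ d) P) (u≡v*d⇒∣d∣∣∣u∣ (n ℤ.* P ℤ.- N ℤ.* + d) d²P≡[nP-Nd]n))) ,
    Coprime.coprime-divisor (Coprime.sym n⊥d′) (Coprime.coprime-divisor (Coprime.sym n⊥d′)
      (subst (d ℕD.∣_) (abs-*-* n P) (u≡v*d⇒∣d∣∣∣u∣ (N ℤ.* n ℤ.+ + d ℤ.* P) n²P≡[Nn+dP]d)))
    where
    open ≡-Reasoning
    d = suc d-1
    P = + (p ℕ.^ k)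
    N = ℚ.↥ a
    n⊥d′ : Coprime.Coprime ℤ.∣ n ∣ d
    n⊥d′ = Coprime.recompute n⊥d
    a*P≡N : a * toℚ P ≡ toℚ N
    a*P≡N = subst (λ m → a * toℚ (+ m) ≡ toℚ N) ↧a≡p^k (*-toℚ-↧≡toℚ-↥ a)
    n²P≡[Nn+dP]d : n ℤ.* (n ℤ.* P) ≡ (N ℤ.* n ℤ.+ + d ℤ.* P) ℤ.* + d
    n²P≡[Nn+dP]d = clear-denominators {a} {x} {n} {N} {+ d} {P} (*-toℚ-↧≡toℚ-↥ x) a*P≡N x²≡ax+1
    d²P≡[nP-Nd]n : + d ℤ.* (+ d ℤ.* P) ≡ (n ℤ.* P ℤ.- N ℤ.* + d) ℤ.* n
    d²P≡[nP-Nd]n = begin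
      + d ℤ.* (+ d ℤ.* P)                                      ≡⟨ rearrange n P N (+ d) ⟩
      (N ℤ.* n ℤ.+ + d ℤ.* P) ℤ.* + d ℤ.- N ℤ.* + d ℤ.* n      ≡⟨ cong (ℤ._- N ℤ.* + d ℤ.* n) n²P≡[Nn+dP]d ⟨
      n ℤ.* (n ℤ.* P) ℤ.- N ℤ.* + d ℤ.* n                      ≡⟨ rearrange′ n P N (+ d) ⟩
      (n ℤ.* P ℤ.- N ℤ.* + d) ℤ.* n                            ∎
      where
      rearrange : ∀ n P N d → d ℤ.* (d ℤ.* P) ≡ (N ℤ.* n ℤ.+ d ℤ.* P) ℤ.* d ℤ.- N ℤ.* d ℤ.* n
      rearrange = ℤ-Solver.solve-∀
      rearrange′ : ∀ n P N d → n ℤ.* (n ℤ.* P) ℤ.- N ℤ.* d ℤ.* n ≡ (n ℤ.* P ℤ.- N ℤ.* d) ℤ.* n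
      rearrange′ = ℤ-Solver.solve-∀

  SignedPowerOf : ℕ → ℚ → Set
  SignedPowerOf p x = ∃ λ ε → IsSign ε × ((∃ λ j → x ≡ ε * pPow p j) ⊎ (∃ λ i → x ≡ ε * invPow p i))

  ∣↥∣≡p^j∧↧ₙ≡p^i⇒SignedPowerOf : ∀ {p} → Prime p → ∀ x i j →
    ℤ.∣ ℚ.↥ x ∣ ≡ p ℕ.^ j → ℚ.↧ₙ x ≡ p ℕ.^ i → SignedPowerOf p x
  ∣↥∣≡p^j∧↧ₙ≡p^i⇒SignedPowerOf {p} p-prime x@(mkℚ n d-1 _) zero j ∣n∣≡p^j d≡1
    with ∣z∣≡m⇒toℚz≡±m n ∣n∣≡p^j
  ... | ε , ε-sign , n≡εp^j = ε , ε-sign , inj₁ (j , (begin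
    x                      ≡⟨ ℚP.*-identityʳ x ⟨
    x * toℚ (+ 1)          ≡⟨ cong (λ m → x * toℚ (+ m)) d≡1 ⟨
    x * toℚ (+ suc d-1)    ≡⟨ *-toℚ-↧≡toℚ-↥ x ⟩
    toℚ n                  ≡⟨ n≡εp^j ⟩
    ε * pPow p j           ∎))
    where open ≡-Reasoning
  ∣↥∣≡p^j∧↧ₙ≡p^i⇒SignedPowerOf {p} p-prime x@(mkℚ n d-1 _) (suc i) zero ∣n∣≡1 d≡p^i
    with ∣z∣≡m⇒toℚz≡±m n ∣n∣≡1
  ... | ε , ε-sign , n≡ε = ε , ε-sign , inj₂ (suc i , (begin
    x                              ≡⟨ ℚP.*-identityʳ x ⟨
    x * 1ℚ                         ≡⟨ cong (x *_) (pPow*invPow p-prime (suc i)) ⟨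
    x * (pPow p (suc i) * w)       ≡⟨ ℚP.*-assoc x (pPow p (suc i)) w ⟨
    x * pPow p (suc i) * w         ≡⟨ cong (λ m → x * toℚ (+ m) * w) d≡p^i ⟨
    x * toℚ (+ suc d-1) * w        ≡⟨ cong (_* w) (trans (*-toℚ-↧≡toℚ-↥ x) n≡ε) ⟩
    ε * 1ℚ * w                     ≡⟨ cong (_* w) (ℚP.*-identityʳ ε) ⟩
    ε * w                          ∎))
    where
    open ≡-Reasoning
    w = invPow p (suc i)
  ∣↥∣≡p^j∧↧ₙ≡p^i⇒SignedPowerOf {p} p-prime (mkℚ n d-1 n⊥d) (suc i) (suc j) ∣n∣≡p^j d≡p^i =
    ⊥-elim (¬prime[1] (subst Prime (Coprime.recompute n⊥d (p∣∣n∣ , p∣d)) p-prime))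
    where
    p∣d : p ℕD.∣ suc d-1
    p∣d = subst (p ℕD.∣_) (sym d≡p^i) (ℕD.m∣m*n (p ℕ.^ i))
    p∣∣n∣ : p ℕD.∣ ℤ.∣ n ∣
    p∣∣n∣ = subst (p ℕD.∣_) (sym ∣n∣≡p^j) (ℕD.m∣m*n (p ℕ.^ j))

  root⇒SignedPowerOf : ∀ {p} → Prime p → ∀ {a x} → InO p a → x * x ≡ a * x + 1ℚ → SignedPowerOf p x
  root⇒SignedPowerOf p-prime {a} {x} (k , ↧a≡p^k) x²≡ax+1
    with root⇒∣↥∣∣p^k×↧ₙ∣p^k {k = k} {a} {x} ↧a≡p^k x²≡ax+1
  ... | ↥x∣p^k , ↧x∣p^k with ∣prime^⇒≡prime^ p-prime k ↥x∣p^k | ∣prime^⇒≡prime^ p-prime k ↧x∣p^k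
  ...   | j , ∣↥x∣≡p^j | i , ↧x≡p^i = ∣↥∣≡p^j∧↧ₙ≡p^i⇒SignedPowerOf p-prime x i j ∣↥x∣≡p^j ↧x≡p^i

  a⋆-root₁ : ∀ {p} → Prime p → ∀ α {ε} → IsSign ε →
    (ε * invPow p α) * (ε * invPow p α) ≡ a⋆ p α ε * (ε * invPow p α) + 1ℚ
  a⋆-root₁ {p} p-prime α {ε} ε-sign =
    subst (λ s → x₁ * x₁ ≡ s * x₁ + 1ℚ) (a⋆-sum p-prime α ε) (Vieta-root {x₁} (a⋆-product p-prime α ε-sign))
    where
    x₁ = ε * invPow p α

  a⋆-root₂ : ∀ {p} → Prime p → ∀ α {ε} → IsSign ε →
    (- (ε * pPow p α)) * (- (ε * pPow p α)) ≡ a⋆ p α ε * (- (ε * pPow p α)) + 1ℚ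
  a⋆-root₂ {p} p-prime α {ε} ε-sign =
    subst (λ s → x₂ * x₂ ≡ s * x₂ + 1ℚ) (trans (ℚP.+-comm x₂ x₁) (a⋆-sum p-prime α ε))
      (Vieta-root {x₂} {x₁} (trans (ℚP.*-comm x₂ x₁) (a⋆-product p-prime α ε-sign)))
    where
    x₁ = ε * invPow p α
    x₂ = - (ε * pPow p α)

  root⇒≡a⋆ : ∀ {p} → Prime p → ∀ {a x} → InO p a → x * x ≡ a * x + 1ℚ →
    ∃ λ α → ∃ λ ε → IsSign ε × a ≡ a⋆ p α ε
  root⇒≡a⋆ {p} p-prime {a} {x} a∈O root with root⇒SignedPowerOf p-prime {a} {x} a∈O root
  ... | ε , ε-sign , inj₁ (j , x≡εQ) = j , - ε , IsSign-neg ε-sign , same-root⇒≡ {x} root x-root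
    where
    -[-ε*Q]≡ε*Q : ∀ ε Q → - (- ε * Q) ≡ ε * Q
    -[-ε*Q]≡ε*Q = solve-∀ ℚ-ring
    x-root : x * x ≡ a⋆ p j (- ε) * x + 1ℚ
    x-root = subst (λ y → y * y ≡ a⋆ p j (- ε) * y + 1ℚ) (trans (-[-ε*Q]≡ε*Q ε (pPow p j)) (sym x≡εQ))
                   (a⋆-root₂ p-prime j (IsSign-neg ε-sign))
  ... | ε , ε-sign , inj₂ (i , x≡εw) = i , ε , ε-sign , same-root⇒≡ {x} root x-root
    where
    x-root : x * x ≡ a⋆ p i ε * x + 1ℚ
    x-root = subst (λ y → y * y ≡ a⋆ p i ε * y + 1ℚ) (sym x≡εw) (a⋆-root₁ p-prime i ε-sign)

  a⋆*p^α : ∀ {p} → Prime p → ∀ α s →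
    a⋆ p α (toℚ s) * pPow p α ≡ toℚ (s ℤ.* (+ 1 ℤ.- + (p ℕ.^ α) ℤ.* + (p ℕ.^ α)))
  a⋆*p^α {p} p-prime α s = begin
    a⋆ p α ε * Q                          ≡⟨ cong (λ t → ε * ((1ℚ - t) * w) * Q) (pPow-2* p α) ⟩
    ε * ((1ℚ - Q * Q) * w) * Q            ≡⟨ regroup ε Q w ⟩
    ε * (1ℚ - Q * Q) * (Q * w)            ≡⟨ cong (ε * (1ℚ - Q * Q) *_) (pPow*invPow p-prime α) ⟩
    ε * (1ℚ - Q * Q) * 1ℚ                 ≡⟨ ℚP.*-identityʳ _ ⟩
    ε * (toℚ (+ 1) - Q * Q)               ≡⟨ cong (λ t → ε * (toℚ (+ 1) - t)) (toℚ-* (+ q) (+ q)) ⟨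
    ε * (toℚ (+ 1) - toℚ (+ q ℤ.* + q))   ≡⟨ cong (ε *_) (toℚ-- (+ 1) (+ q ℤ.* + q)) ⟨
    ε * toℚ (+ 1 ℤ.- + q ℤ.* + q)         ≡⟨ toℚ-* s (+ 1 ℤ.- + q ℤ.* + q) ⟨
    toℚ (s ℤ.* (+ 1 ℤ.- + q ℤ.* + q))     ∎
    where
    open ≡-Reasoning
    ε = toℚ s
    q = p ℕ.^ α
    Q = pPow p α
    w = invPow p α
    regroup : ∀ e Q w → e * ((1ℚ - Q * Q) * w) * Q ≡ e * (1ℚ - Q * Q) * (Q * w)
    regroup = solve-∀ ℚ-ring

  *p^α-integral⇒InO : ∀ {p} → Prime p → ∀ α {a} c → a * pPow p α ≡ toℚ c → InO p a
  *p^α-integral⇒InO p-prime α {a} c a*p^α≡c =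
    ∣prime^⇒≡prime^ p-prime α (v*r≡u⇒↧ₙr∣∣v∣ c (+ _) a (trans (ℚP.*-comm _ a) a*p^α≡c))

  a⋆-admissible : ∀ {p} → Prime p → ∀ {α ε} → 0 ℕ.< α → IsSign ε →
    InO p (a⋆ p α ε) × PAdicConverges p (λ _ → a⋆ p α ε)
  a⋆-admissible {p} p-prime {suc α} {ε} _ ε-sign with IsSign⇒unit ε-sign
  ... | s , ∣s∣≡1 , refl =
    *p^α-integral⇒InO p-prime (suc α) {a⋆ p (suc α) ε} c (a⋆*p^α p-prime (suc α) s) ,
    ConstantContinuedFraction.converges p-prime q c p∣q p∤c (a⋆ p (suc α) ε) (a⋆*p^α p-prime (suc α) s)
    where
    q = p ℕ.^ suc α
    c = s ℤ.* (+ 1 ℤ.- + q ℤ.* + q)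
    p∣q : p ℕD.∣ q
    p∣q = ℕD.m∣m*n (p ℕ.^ α)
    p∤1-q² : ¬ (p ℕD.∣ ℤ.∣ + 1 ℤ.- + q ℤ.* + q ∣)
    p∤1-q² p∣1-q² = prime∤1 p-prime (ℤD.∣⇒∣ᵤ (subst (ℤD._∣_ (+ p)) (1-x+x≡1 (+ q ℤ.* + q))
      (ℤD.∣m∣n⇒∣m+n (ℤD.∣ᵤ⇒∣ {+ p} {+ 1 ℤ.- + q ℤ.* + q} p∣1-q²)
                    (ℤD.∣m⇒∣m*n {+ p} {+ q} (+ q) (ℤD.∣ᵤ⇒∣ p∣q)))))
      where
      1-x+x≡1 : ∀ x → + 1 ℤ.- x ℤ.+ x ≡ + 1
      1-x+x≡1 = ℤ-Solver.solve-∀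
    p∤c : ¬ (p ℕD.∣ ℤ.∣ c ∣)
    p∤c = prime∤* p-prime (subst (λ m → ¬ (p ℕD.∣ m)) (sym ∣s∣≡1) (prime∤1 p-prime)) p∤1-q²
          ∘ subst (p ℕD.∣_) (ℤP.abs-* s _)

  RootsAre⇒InV-a⋆ : ∀ {p A B C} → Prime p → ∀ α {ε} → IsSign ε →
    RootsAre A B C (ε * invPow p α) (- (ε * pPow p α)) → A ≢ 0ℚ × InV A B C (a⋆ p α ε)
  RootsAre⇒InV-a⋆ {p} {A} {B} {C} p-prime α {ε} ε-sign roots =
    proj₁ A≢0×s∈V , subst (InV A B C) (a⋆-sum p-prime α ε) (proj₂ A≢0×s∈V)
    where
    A≢0×s∈V : A ≢ 0ℚ × InV A B C (ε * invPow p α + - (ε * pPow p α))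
    A≢0×s∈V = RootsAre⇒InV {A} {B} {C} {ε * invPow p α} { - (ε * pPow p α) } (a⋆-product p-prime α ε-sign) roots

  InV-a⋆⇒RootsAre : ∀ {p A B C} → Prime p → ∀ α {ε} → IsSign ε →
    A ≢ 0ℚ → InV A B C (a⋆ p α ε) → RootsAre A B C (ε * invPow p α) (- (ε * pPow p α))
  InV-a⋆⇒RootsAre {p} {A} {B} {C} p-prime α {ε} ε-sign A≢0 a⋆∈V =
    InV⇒RootsAre {A} {B} {C} {ε * invPow p α} { - (ε * pPow p α) } (a⋆-product p-prime α ε-sign) A≢0
      (subst (InV A B C) (sym (a⋆-sum p-prime α ε)) a⋆∈V)

  InVcon⇒≡a⋆ : ∀ {p A B C a} → Prime p → NonzeroPoly A B C → Reducible A B C → InVcon p A B C a →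
    ∃ λ α → 0 ℕ.< α × ∃ λ ε → IsSign ε × a ≡ a⋆ p α ε
  InVcon⇒≡a⋆ {p} {A} {B} {C} {a} p-prime F≢0 F-reducible (a∈O , a∈V , a-converges) =
    exclude-α≡0 (root⇒≡a⋆ p-prime {a} {proj₁ a-root} a∈O (proj₂ a-root))
    where
    A≢0 : A ≢ 0ℚ
    A≢0 = InV⇒A≢0 {A} {B} {C} {a} F≢0 a∈V
    a-root : ∃ λ x → x * x ≡ a * x + 1ℚ
    a-root = map₂ (InV∧root⇒root {A} {B} {C} {a} A≢0 a∈V) (Reducible⇒root {A} {B} {C} A≢0 F-reducible)
    exclude-α≡0 : (∃ λ α → ∃ λ ε → IsSign ε × a ≡ a⋆ p α ε) →
                  ∃ λ α → 0 ℕ.< α × ∃ λ ε → IsSign ε × a ≡ a⋆ p α ε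
    exclude-α≡0 (zero , ε , _ , a≡a⋆) =
      ⊥-elim (zero-diverges (subst (λ b → PAdicConverges p (λ _ → b)) (trans a≡a⋆ (a⋆[0]≡0 p ε)) a-converges))
    exclude-α≡0 (suc α , ε , ε-sign , a≡a⋆) = suc α , ℕ.s≤s ℕ.z≤n , ε , ε-sign , a≡a⋆

  InVcon⇒RootsAre : ∀ {p A B C a} → Prime p → NonzeroPoly A B C → Reducible A B C → InVcon p A B C a →
    ∃ λ α → 0 ℕ.< α × ∃ λ ε → IsSign ε × RootsAre A B C (ε * invPow p α) (- (ε * pPow p α))
  InVcon⇒RootsAre {p} {A} {B} {C} {a} p-prime F≢0 F-reducible a∈Vcon@(_ , a∈V , _) =
    roots (InVcon⇒≡a⋆ p-prime F≢0 F-reducible a∈Vcon)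
    where
    roots : (∃ λ α → 0 ℕ.< α × ∃ λ ε → IsSign ε × a ≡ a⋆ p α ε) →
      ∃ λ α → 0 ℕ.< α × ∃ λ ε → IsSign ε × RootsAre A B C (ε * invPow p α) (- (ε * pPow p α))
    roots (α , 0<α , ε , ε-sign , a≡a⋆) = α , 0<α , ε , ε-sign ,
      InV-a⋆⇒RootsAre p-prime α ε-sign (InV⇒A≢0 {A} {B} {C} {a} F≢0 a∈V) (subst (InV A B C) a≡a⋆ a∈V)

  InVcon⇔≡a⋆ : ∀ {p A B C α ε} → Prime p → 0 ℕ.< α → IsSign ε →
    RootsAre A B C (ε * invPow p α) (- (ε * pPow p α)) → ∀ a → InVcon p A B C a ⇔ (a ≡ a⋆ p α ε)
  InVcon⇔≡a⋆ {p} {A} {B} {C} {α} {ε} p-prime 0<α ε-sign roots a =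
    mk⇔ (λ (_ , a∈V , _) → InV-unique {A} {B} {C} A≢0 a∈V a⋆∈V)
        (λ a≡a⋆ → subst (InVcon p A B C) (sym a≡a⋆) (a⋆∈O , a⋆∈V , a⋆-converges))
    where
    A≢0 = proj₁ (RootsAre⇒InV-a⋆ p-prime α ε-sign roots)
    a⋆∈V = proj₂ (RootsAre⇒InV-a⋆ p-prime α ε-sign roots)
    a⋆∈O = proj₁ (a⋆-admissible p-prime 0<α ε-sign)
    a⋆-converges = proj₂ (a⋆-admissible p-prime 0<α ε-sign)

open Lemmas
open import Data.Nat using (ℕ; _<_; _*_)
open import Data.Nat.Divisibility using (_∣_)
open import Data.Nat.Primality using (Prime)
open import Data.Rational as ℚ using (ℚ; 1ℚ; -_)
open import Data.Product using (∃; _×_; _,_)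
open import Function.Bundles using (_⇔_; mk⇔; Equivalence)
open import Relation.Nullary using (¬_)
open import Relation.Binary.PropositionalEquality using (_≡_; refl)

proposition4p3 : (p : ℕ) → Prime p → ¬ (2 ∣ p) →
    (A B C : ℚ) → NonzeroPoly A B C → Reducible A B C →
    ((∃ λ a₁ → InVcon p A B C a₁) ⇔
      (∃ λ α → 0 < α × (∃ λ ε → IsSign ε ×
        RootsAre A B C (ε ℚ.* invPow p α) (- (ε ℚ.* pPow p α)))))
    ×
    (∀ (α : ℕ) (ε : ℚ) → 0 < α → IsSign ε →
      RootsAre A B C (ε ℚ.* invPow p α) (- (ε ℚ.* pPow p α)) →
      ∀ (a₁ : ℚ) → (InVcon p A B C a₁ ⇔
        (a₁ ≡ ε ℚ.* ((1ℚ ℚ.- pPow p (2 * α)) ℚ.* invPow p α))))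
-- The argument does not use that p is odd.
proposition4p3 p p-prime _ A B C F≢0 F-reducible =
  mk⇔ (λ (a₁ , a₁∈Vcon) → InVcon⇒RootsAre p-prime F≢0 F-reducible a₁∈Vcon)
      (λ (α , 0<α , ε , ε-sign , roots) →
        a⋆ p α ε , Equivalence.from (InVcon⇔≡a⋆ p-prime 0<α ε-sign roots (a⋆ p α ε)) refl) ,
  λ α ε 0<α ε-sign roots → InVcon⇔≡a⋆ p-prime 0<α ε-sign roots
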